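{- Let $\pi$ be a priority policy for an instance $I$ of Flow Shop Scheduling with Stochastic Reentry. Then for every $k\in\{1,\dots,m\}$ the policy $\pi_k$ induced by $\pi$ on the auxiliary instance $I_k$ is also a priority policy, and it uses the same priority values as $\pi$.
   Context: Flow Shop Scheduling with Stochastic Reentry: there are machines $1,\dots,m$ and jobs $1,\dots,n$; job $j$ requires $Y_j$ passes ("loops") through machines $1,\dots,m$ in this order, where $Y_1,\dots,Y_n$ are independent positive-integer-valued random variables with known distributions but unknown realizations. Every operation takes unit time. A loop started on machine $1$ at integer time $\tau$ is processed on machine $i$ during $[\tau+i-1,\tau+i)$ and completes at $\tau+m$; at most one loop may start at each integer time, and the loops of a job are processed one after another. A policy decides at each integer time either to start a loop of an uncompleted job not currently in a loop (an available job), or nothing, non-anticipatorily. A priority policy assigns a fixed (static) priority value to each job and at every integer time starts a loop of the available uncompleted job with the largest priority value (with a fixed tie-breaking rule); such policies are non-interruptive, i.e. a job that finishes a loop without being completed is immediately restarted on machine $1$. Stochastic Scheduling with Machine Arrivals: $m$ identical parallel machines, machine $i$ usable only from arrival time $a_i$; jobs with random processing times $X_j$. A priority policy here is non-preemptive list scheduling: each job is processed without interruption on a single machine, and whenever a machine has arrived and is idle, it starts the not-yet-started job with the largest priority value (ties broken by the fixed rule). Auxiliary instances: for $k\in\{1,\dots,m\}$, $I_k$ has $m$ machines with arrival times $a_i^k=0$ if $i+k\le m+1$ and $a_i^k=1$ otherwise, and a job $j$ with $X_j=Y_j$ for each job $j$ of $I$. Induced policy: given $\pi$ for $I$, whenever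 $\pi$ starts a loop of job $j$ (or idles) at time $\tau=mt+i-1$ with $t=\lfloor\tau/m\rfloor$, $i=(\tau\bmod m)+1$, the induced policy $\pi_k$ processes job $j$ (or idles) on machine $i$ during $[t+a_i^k,t+a_i^k+1)$. -}

module Defs where

open import Data.Nat using (ℕ; zero; suc; _+_; _*_; _∸_; _≤_; _<_; _≤ᵇ_)
open import Data.Fin using (Fin; toℕ)
open import Data.Maybe using (Maybe; just; nothing)
open import Data.Bool using (if_then_else_)
open import Data.Product using (Σ; ∃; _×_)
open import Data.Sum using (_⊎_)
open import Relation.Binary.PropositionalEquality using (_≡_)
open import Relation.Nullary using (¬_)

-- A priority policy is given by static priority values
-- prio : Fin n → ℕ (larger = more urgent) together with a fixed
-- tie-breaking rule tb : Fin n → ℕ (assumed injective; among jobs with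
-- equal priority value the one with smaller tb wins).
-- j ≻ j'  means: j is preferred over j'.

_≻[_,_]_ : {n : ℕ} → Fin n → (Fin n → ℕ) → (Fin n → ℕ) → Fin n → Set
j ≻[ prio , tb ] j' = (prio j' < prio j) ⊎ ((prio j ≡ prio j') × (tb j < tb j'))

-- Flow shop with reentry, for one realization Y : Fin n → ℕ of the
-- loop numbers.  A run is described by its decisions
-- d : ℕ → Maybe (Fin n):  d τ = just j  means a loop of j is started on
-- machine 1 at time τ,  d τ = nothing  means idling.

countBefore : {n : ℕ} → (ℕ → Maybe (Fin n)) → Fin n → ℕ → ℕ
countBefore d j zero = zero
countBefore {n} d j (suc τ) with d τ
... | nothing = countBefore d j τ
... | just j' with toℕ j' Data.Nat.≡ᵇ toℕ j
...   | Data.Bool.true  = suc (countBefore d j τ)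
...   | Data.Bool.false = countBefore d j τ

-- number of loops of j completed by time τ (a loop started at τ'
-- completes at τ' + m, i.e. those with τ' + m ≤ τ, i.e. τ' < τ + 1 ∸ m)
completedLoops : {n : ℕ} → (m : ℕ) → (ℕ → Maybe (Fin n)) → Fin n → ℕ → ℕ
completedLoops m d j τ = countBefore d j (suc τ ∸ m)

InLoop : {n : ℕ} → (m : ℕ) → (ℕ → Maybe (Fin n)) → ℕ → Fin n → Set
InLoop m d τ j = ∃ λ τ' → (τ' < τ) × (τ < τ' + m) × (d τ' ≡ just j)

Available : {n : ℕ} → (m : ℕ) → (Fin n → ℕ) → (ℕ → Maybe (Fin n)) → ℕ → Fin n → Set
Available m Y d τ j = (completedLoops m d j τ < Y j) × ¬ InLoop m d τ j

IsFlowShopPriorityRun : (m n : ℕ) → (Y : Fin n → ℕ) → (prio tb : Fin n → ℕ)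
  → (ℕ → Maybe (Fin n)) → Set
IsFlowShopPriorityRun m n Y prio tb d =
    (∀ τ j → d τ ≡ just j → Available m Y d τ j)
  × (∀ τ → d τ ≡ nothing → ∀ j → ¬ Available m Y d τ j)
  × (∀ τ j j' → d τ ≡ just j → Available m Y d τ j' → (j ≡ j') ⊎ (j ≻[ prio , tb ] j'))

-- Parallel machines with arrival times a : Fin m → ℕ, jobs with
-- (realized) processing times X : Fin n → ℕ.  A schedule is given by
-- S : Fin m → ℕ → Maybe (Fin n):  S i s = just j  means machine i
-- processes j during [s, s+1).
-- S is a non-preemptive list schedule with priorities (prio, tb) iff
-- there are a machine μ j and a start time b j for every job such that
--  * j is processed exactly on machine μ j during [b j, b j + X j)
--    (so without interruption on a single machine),
--  * no job starts before its machine arrives,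
--  * an arrived machine is idle at s only if every job has started by s,
--  * jobs are started in priority order: if j starts strictly before j',
--    then j is preferred over j'.
IsListSchedule : (m n : ℕ) → (a : Fin m → ℕ) → (X : Fin n → ℕ) → (prio tb : Fin n → ℕ)
  → (Fin m → ℕ → Maybe (Fin n)) → Set
IsListSchedule m n a X prio tb S =
  Σ (Fin n → Fin m) λ μ → Σ (Fin n → ℕ) λ b →
      (∀ i s j → S i s ≡ just j → (μ j ≡ i) × (b j ≤ s) × (s < b j + X j))
    × (∀ i s j → (μ j ≡ i) → (b j ≤ s) → (s < b j + X j) → S i s ≡ just j)
    × (∀ j → a (μ j) ≤ b j)
    × (∀ i s → a i ≤ s → S i s ≡ nothing → ∀ j → b j ≤ s)
    × (∀ j j' → b j < b j' → j ≻[ prio , tb ] j')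

-- Auxiliary instance I_k: machine i (0-based index toℕ i, i.e. paper's
-- machine toℕ i + 1) arrives at 0 if (toℕ i + 1) + k ≤ m + 1, else at 1.
arrival : (m k : ℕ) → Fin m → ℕ
arrival m k i = if (toℕ i + k) ≤ᵇ m then 0 else 1

-- Induced schedule π_k: the decision of π at time τ = m t + (i - 1)
-- (paper's machine i, here Fin index with toℕ = i - 1) is processed on
-- machine i during [t + a_i^k, t + a_i^k + 1).
induced : {n : ℕ} → (m k : ℕ) → (ℕ → Maybe (Fin n)) → Fin m → ℕ → Maybe (Fin n)
induced m k d i s =
  if arrival m k i ≤ᵇ s then d (m * (s ∸ arrival m k i) + toℕ i) else nothing

-- A priority run of the reentrant flow shop never interrupts a job: once
-- job j starts its first loop at time t_j, its loops start exactly at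
-- t_j, t_j + m, ..., t_j + (Y_j - 1) m, since at each loop end j is again
-- available and any job preferred to j would have been available, and
-- chosen, already when j's previous loop started.  The decision taken at
-- time τ runs on machine τ mod m at time ⌊τ/m⌋ + a_{τ mod m}, so all loops of j land
-- consecutively on machine t_j mod m, i.e. j is processed non-preemptively
-- from b_j = ⌊t_j/m⌋ + a_{t_j mod m} on.  Since the arrival times are 0/1
-- and non-decreasing in the machine index, τ ↦ ⌊τ/m⌋ + a_{τ mod m} is
-- monotone, so list-schedule start times are ordered like the first starts,
-- which the run orders by priority.
module Submission where

open import Defs
open import Data.Nat using (ℕ; zero; suc; _≤′_; ≤′-refl; ≤′-step; _+_; _*_; _∸_; _≤_; _<_; _≤ᵇ_; _≡ᵇ_; NonZero; >-nonZero; >-nonZero⁻¹; z≤n; s≤s)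
open import Data.Nat.Properties
open import Data.Nat.DivMod using (_/_; _%_; _mod_; m≡m%n+[m/n]*n; m*n/n≡m; m<n⇒m%n≡m; m<n⇒m/n≡0; %-remove-+ˡ; +-distrib-/-∣ˡ; /-monoˡ-≤; m%n<n)
open import Data.Nat.Divisibility using (m∣m*n; n∣m*n)
open import Data.Nat.Induction using (<-rec)
open import Algebra.Properties.CommutativeMonoid.Sum +-0-commutativeMonoid using (sum; sum-cong-≗; sum-replicate-zero; ∑-distrib-+)
open import Data.Fin using (Fin; toℕ) renaming (zero to fzero; suc to fsuc)
open import Data.Fin.Properties using (toℕ-injective; toℕ-fromℕ<; toℕ<n) renaming (_≟_ to _≟ᶠ_)
open import Data.Maybe using (Maybe; just; nothing)
open import Data.Maybe.Properties using (just-injective; ≡-dec)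
open import Data.Bool using (true; false; if_then_else_)
open import Data.Product using (∃; _×_; _,_; proj₁; proj₂)
open import Data.Sum using (_⊎_; inj₁; inj₂)
open import Data.Empty using (⊥-elim)
open import Function using (_∘_)
open import Function.Definitions using (Injective)
open import Relation.Binary.PropositionalEquality
open import Relation.Binary.Definitions using (tri<; tri≈; tri>)
open import Relation.Nullary using (¬_; yes; no)
open import Relation.Nullary.Reflects using (Reflects; ofʸ; ofⁿ; fromEquivalence)
open import Relation.Unary using (Decidable)

module Priority {n : ℕ} (prio tb : Fin n → ℕ) where

  ≻-irrefl : ∀ {j} → ¬ (j ≻[ prio , tb ] j)
  ≻-irrefl (inj₁ p)       = <-irrefl refl p
  ≻-irrefl (inj₂ (_ , p)) = <-irrefl refl p

  ≻-asym : ∀ {j j'} → j ≻[ prio , tb ] j' → ¬ (j' ≻[ prio , tb ] j)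
  ≻-asym (inj₁ p)       (inj₁ q)       = <-asym p q
  ≻-asym (inj₁ p)       (inj₂ (e , _)) = <-irrefl e p
  ≻-asym (inj₂ (e , _)) (inj₁ q)       = <-irrefl e q
  ≻-asym (inj₂ (_ , p)) (inj₂ (_ , q)) = <-asym p q

Least : (ℕ → Set) → ℕ → Set
Least P t = P t × (∀ {ρ} → ρ < t → ¬ P ρ)

minimal-witness : {P : ℕ → Set} → Decidable P → ∀ {t} → P t → ∃ (Least P)
minimal-witness {P} P? {t} = <-rec (λ t → P t → ∃ (Least P)) step t
  where
  step : ∀ t → (∀ {ρ} → ρ < t → P ρ → ∃ (Least P)) → P t → ∃ (Least P)
  step t smaller Pt with anyUpTo? P? t
  ... | yes (ρ , ρ<t , Pρ) = smaller ρ<t Pρ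
  ... | no none           = t , Pt , λ ρ<t Pρ → none (_ , ρ<t , Pρ)

module _ {n : ℕ} where

  -- Indices are compared as in countBefore, so that countBefore-suc holds by computation.
  startsOf : Maybe (Fin n) → Fin n → ℕ
  startsOf nothing   j = 0
  startsOf (just j') j = if toℕ j' ≡ᵇ toℕ j then 1 else 0

  private
    toℕ-≡ᵇ-reflects : (i j : Fin n) → Reflects (i ≡ j) (toℕ i ≡ᵇ toℕ j)
    toℕ-≡ᵇ-reflects i j = fromEquivalence (toℕ-injective ∘ ≡ᵇ⇒≡ _ _) (≡⇒≡ᵇ _ _ ∘ cong toℕ)

  startsOf-self : (j : Fin n) → startsOf (just j) j ≡ 1
  startsOf-self j with toℕ j ≡ᵇ toℕ j | toℕ-≡ᵇ-reflects j j
  ... | true  | _       = refl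
  ... | false | ofⁿ j≢j = ⊥-elim (j≢j refl)

  startsOf-other : ∀ x (j : Fin n) → x ≢ just j → startsOf x j ≡ 0
  startsOf-other nothing   j _  = refl
  startsOf-other (just j') j x≢j with toℕ j' ≡ᵇ toℕ j | toℕ-≡ᵇ-reflects j' j
  ... | true  | ofʸ j'≡j = ⊥-elim (x≢j (cong just j'≡j))
  ... | false | _        = refl

∑-startsOf : ∀ {n} (j₀ : Fin n) → sum (startsOf (just j₀)) ≡ 1
∑-startsOf {suc n} fzero      = cong suc (sum-replicate-zero n)
∑-startsOf {suc n} (fsuc j₀) = ∑-startsOf j₀

sum-mono-≤ : ∀ {n} {f g : Fin n → ℕ} → (∀ j → f j ≤ g j) → sum f ≤ sum g
sum-mono-≤ {zero}  f≤g = z≤n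
sum-mono-≤ {suc n} f≤g = +-mono-≤ (f≤g fzero) (sum-mono-≤ (f≤g ∘ fsuc))

≢-nothing : ∀ {A : Set} {x : Maybe A} → x ≢ nothing → ∃ λ a → x ≡ just a
≢-nothing {x = nothing} x≢nothing = ⊥-elim (x≢nothing refl)
≢-nothing {x = just a}  _         = a , refl

module _ {n : ℕ} (d : ℕ → Maybe (Fin n)) where

  countBefore-suc : ∀ j τ → countBefore d j (suc τ) ≡ countBefore d j τ + startsOf (d τ) j
  countBefore-suc j τ with d τ
  ... | nothing = sym (+-identityʳ _)
  ... | just j' with toℕ j' ≡ᵇ toℕ j
  ...   | true  = +-comm 1 _
  ...   | false = sym (+-identityʳ _)

  countBefore-start : ∀ {j τ} → d τ ≡ just j → countBefore d j (suc τ) ≡ suc (countBefore d j τ)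
  countBefore-start {j} {τ} dτ = begin
    countBefore d j (suc τ)                 ≡⟨ countBefore-suc j τ ⟩
    countBefore d j τ + startsOf (d τ) j    ≡⟨ cong (λ x → countBefore d j τ + startsOf x j) dτ ⟩
    countBefore d j τ + startsOf (just j) j ≡⟨ cong (countBefore d j τ +_) (startsOf-self j) ⟩
    countBefore d j τ + 1                   ≡⟨ +-comm _ 1 ⟩
    suc (countBefore d j τ)                 ∎
    where open ≡-Reasoning

  countBefore-skip : ∀ {j τ} → d τ ≢ just j → countBefore d j (suc τ) ≡ countBefore d j τ
  countBefore-skip {j} {τ} dτ≢j = begin
    countBefore d j (suc τ)              ≡⟨ countBefore-suc j τ ⟩
    countBefore d j τ + startsOf (d τ) j ≡⟨ cong (countBefore d j τ +_) (startsOf-other (d τ) j dτ≢j) ⟩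
    countBefore d j τ + 0                ≡⟨ +-identityʳ _ ⟩
    countBefore d j τ                    ∎
    where open ≡-Reasoning

  countBefore-mono : ∀ j {a b} → a ≤ b → countBefore d j a ≤ countBefore d j b
  countBefore-mono j = go ∘ ≤⇒≤′
    where
    go : ∀ {a b} → a ≤′ b → countBefore d j a ≤ countBefore d j b
    go ≤′-refl            = ≤-refl
    go (≤′-step {b} a≤′b) =
      ≤-trans (go a≤′b) (≤-trans (m≤m+n _ _) (≤-reflexive (sym (countBefore-suc j b))))

  countBefore-const : ∀ j {a b} → a ≤ b → (∀ {y} → a ≤ y → y < b → d y ≢ just j) →
                      countBefore d j b ≡ countBefore d j a
  countBefore-const j = go ∘ ≤⇒≤′
    where
    go : ∀ {a b} → a ≤′ b → (∀ {y} → a ≤ y → y < b → d y ≢ just j) → countBefore d j b ≡ countBefore d j a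
    go ≤′-refl            _     = refl
    go (≤′-step {b} a≤′b) quiet =
      trans (countBefore-skip (quiet (≤′⇒≤ a≤′b) ≤-refl)) (go a≤′b (λ a≤y y<b → quiet a≤y (m<n⇒m<1+n y<b)))

  ∑-countBefore-start : ∀ {j₀ B} → d B ≡ just j₀ →
                        sum (λ j → countBefore d j (suc B)) ≡ sum (λ j → countBefore d j B) + 1
  ∑-countBefore-start {j₀} {B} dB = begin
    sum (λ j → countBefore d j (suc B))             ≡⟨ sum-cong-≗ (λ j → countBefore-suc j B) ⟩
    sum (λ j → countBefore d j B + startsOf (d B) j) ≡⟨ ∑-distrib-+ (λ j → countBefore d j B) (startsOf (d B)) ⟩
    ∑c + sum (startsOf (d B))                        ≡⟨ cong (λ x → ∑c + sum (startsOf x)) dB ⟩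
    ∑c + sum (startsOf (just j₀))                    ≡⟨ cong (∑c +_) (∑-startsOf j₀) ⟩
    ∑c + 1                                           ∎
    where
    open ≡-Reasoning
    ∑c = sum (λ j → countBefore d j B)

  busy-bound : ∀ B → (∀ {τ} → τ < B → d τ ≢ nothing) → B ≤ sum (λ j → countBefore d j B)
  busy-bound zero    _    = z≤n
  busy-bound (suc B) busy = begin
    suc B                              ≡⟨ +-comm 1 B ⟩
    B + 1                              ≤⟨ +-monoˡ-≤ 1 (busy-bound B (busy ∘ m<n⇒m<1+n)) ⟩
    sum (λ j → countBefore d j B) + 1  ≡⟨ ∑-countBefore-start (proj₂ (≢-nothing (busy ≤-refl))) ⟨
    sum (λ j → countBefore d j (suc B)) ∎
    where open ≤-Reasoning

module PriorityRun
  {m n : ℕ} .{{_ : NonZero m}} {Y : Fin n → ℕ} (Y≥1 : ∀ j → 1 ≤ Y j)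
  {prio tb : Fin n → ℕ} {d : ℕ → Maybe (Fin n)}
  (run : IsFlowShopPriorityRun m n Y prio tb d) where

  open Priority prio tb

  started⇒available : ∀ {τ j} → d τ ≡ just j → Available m Y d τ j
  started⇒available = proj₁ run _ _

  idle⇒unavailable : ∀ {τ} → d τ ≡ nothing → ∀ j → ¬ Available m Y d τ j
  idle⇒unavailable = proj₁ (proj₂ run) _

  started⇒preferred : ∀ {τ j j'} → d τ ≡ just j → Available m Y d τ j' →
                      j ≡ j' ⊎ j ≻[ prio , tb ] j'
  started⇒preferred = proj₂ (proj₂ run) _ _ _

  start-gap : ∀ {ρ τ j} → d ρ ≡ just j → d τ ≡ just j → ρ < τ → ρ + m ≤ τ
  start-gap dρ dτ ρ<τ = ≮⇒≥ (λ τ<ρ+m → proj₂ (started⇒available dτ) (_ , ρ<τ , τ<ρ+m , dρ))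

  loop-ends : ∀ {x j} → d x ≡ just j → ¬ InLoop m d (x + m) j
  loop-ends {x} dx (τ , τ<x+m , x+m<τ+m , dτ) =
    <⇒≱ τ<x+m (start-gap dx dτ (+-cancelʳ-< m x τ x+m<τ+m))

  completedLoops-after : ∀ x j → completedLoops m d j (x + m) ≡ countBefore d j (suc x)
  completedLoops-after x j = cong (countBefore d j) (m+n∸n≡m (suc x) m)

  completedLoops-mono : ∀ j {τ τ'} → τ ≤ τ' → completedLoops m d j τ ≤ completedLoops m d j τ'
  completedLoops-mono j τ≤τ' = countBefore-mono d j (∸-monoˡ-≤ m (s≤s τ≤τ'))

  completedLoops-at-start : ∀ {τ j} → d τ ≡ just j → completedLoops m d j τ ≡ countBefore d j τ
  completedLoops-at-start {τ} {j} dτ =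
    sym (countBefore-const d j (∸-monoʳ-≤ (suc τ) (>-nonZero⁻¹ m)) quiet)
    where
    quiet : ∀ {y} → suc τ ∸ m ≤ y → y < τ → d y ≢ just j
    quiet {y} τ+1∸m≤y y<τ dy = <⇒≱ (s≤s (start-gap dy dτ y<τ))
      (≤-trans (m≤n+m∸n (suc τ) m) (≤-trans (+-monoʳ-≤ m τ+1∸m≤y) (≤-reflexive (+-comm m y))))

  unstarted⇒available : ∀ {τ j} → (∀ {ρ} → ρ < τ → d ρ ≢ just j) → Available m Y d τ j
  unstarted⇒available {τ} {j} unstarted = nothing-completed , λ (ρ , ρ<τ , _ , dρ) → unstarted ρ<τ dρ
    where
    nothing-completed : completedLoops m d j τ < Y j
    nothing-completed = subst (_< Y j) (sym (countBefore-const d j z≤n quiet)) (Y≥1 j)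
      where
      quiet : ∀ {y} → 0 ≤ y → y < suc τ ∸ m → d y ≢ just j
      quiet _ y<τ+1∸m = unstarted (<-≤-trans y<τ+1∸m (∸-monoʳ-≤ (suc τ) (>-nonZero⁻¹ m)))

  countBefore-≤-loops : ∀ j τ → countBefore d j τ ≤ Y j
  countBefore-≤-loops j zero = z≤n
  countBefore-≤-loops j (suc τ) with ≡-dec _≟ᶠ_ (d τ) (just j)
  ... | yes dτ   = subst (_≤ Y j) (sym (countBefore-start d dτ))
                     (subst (_< Y j) (completedLoops-at-start dτ) (proj₁ (started⇒available dτ)))
  ... | no dτ≢j = subst (_≤ Y j) (sym (countBefore-skip d dτ≢j)) (countBefore-≤-loops j τ)

  -- A never-started job would keep every slot busy, yet at most ∑ Y loops are ever started.
  started-eventually : ∀ j → ∃ λ τ → d τ ≡ just j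
  started-eventually j with anyUpTo? (λ τ → ≡-dec _≟ᶠ_ (d τ) (just j)) (suc (sum Y))
  ... | yes (τ , _ , dτ) = τ , dτ
  ... | no never          = ⊥-elim (1+n≰n (≤-trans (busy-bound d (suc (sum Y)) busy)
                                        (sum-mono-≤ (λ j' → countBefore-≤-loops j' (suc (sum Y))))))
    where
    busy : ∀ {τ} → τ < suc (sum Y) → d τ ≢ nothing
    busy τ<B dτ = idle⇒unavailable dτ j
      (unstarted⇒available (λ ρ<τ dρ → never (_ , <-trans ρ<τ τ<B , dρ)))

  private
    first : ∀ j → ∃ (Least (λ t → d t ≡ just j))
    first j = minimal-witness (λ τ → ≡-dec _≟ᶠ_ (d τ) (just j)) (proj₂ (started-eventually j))

  firstStart : Fin n → ℕ
  firstStart j = proj₁ (first j)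

  firstStart-started : ∀ j → d (firstStart j) ≡ just j
  firstStart-started j = proj₁ (proj₂ (first j))

  unstarted-before-firstStart : ∀ j {ρ} → ρ < firstStart j → d ρ ≢ just j
  unstarted-before-firstStart j = proj₂ (proj₂ (first j))

  -- Proved together by strong induction on T: locating the loop that ends at T
  -- only uses restarts strictly before T.
  Restart : ℕ → Set
  Restart T = ∀ {x j} → x + m ≡ T → d x ≡ just j → countBefore d j (suc x) < Y j → d T ≡ just j

  PreviousLoop : ℕ → Set
  PreviousLoop T = ∀ {ρ j} → d T ≡ just j → ρ < T → d ρ ≡ just j → ∃ λ x → x + m ≡ T × d x ≡ just j

  previousLoop-from : ∀ {T} → (∀ {T'} → T' < T → Restart T') → PreviousLoop T
  previousLoop-from {T} restart {ρ₀} {j} dT ρ₀<T dρ₀ = walk T (m≤n+m T ρ₀) ρ₀<T dρ₀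
    where
    walk : ∀ fuel {ρ} → T ≤ ρ + fuel → ρ < T → d ρ ≡ just j → ∃ λ x → x + m ≡ T × d x ≡ just j
    walk zero       {ρ} T≤ρ+0      ρ<T _  = ⊥-elim (<⇒≱ ρ<T (≤-trans T≤ρ+0 (≤-reflexive (+-identityʳ ρ))))
    walk (suc fuel) {ρ} T≤ρ+fuel+1 ρ<T dρ with ρ + m ≟ T
    ... | yes ρ+m≡T = ρ , ρ+m≡T , dρ
    ... | no ρ+m≢T  = walk fuel T≤ρ+m+fuel ρ+m<T (restart ρ+m<T refl dρ unfinished)
      where
      ρ+m<T : ρ + m < T
      ρ+m<T = ≤∧≢⇒< (start-gap dρ dT ρ<T) ρ+m≢T
      T≤ρ+m+fuel : T ≤ ρ + m + fuel
      T≤ρ+m+fuel = ≤-trans T≤ρ+fuel+1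
        (≤-trans (+-monoʳ-≤ ρ (+-monoˡ-≤ fuel (>-nonZero⁻¹ m))) (≤-reflexive (sym (+-assoc ρ m fuel))))
      unfinished : countBefore d j (suc ρ) < Y j
      unfinished = subst (_< Y j) (completedLoops-after ρ j)
        (≤-<-trans (completedLoops-mono j (<⇒≤ ρ+m<T)) (proj₁ (started⇒available dT)))

  available-after-loop : ∀ {x j} → d x ≡ just j → countBefore d j (suc x) < Y j →
                         Available m Y d (x + m) j
  available-after-loop {x} {j} dx unfinished =
    subst (_< Y j) (sym (completedLoops-after x j)) unfinished , loop-ends dx

  rival-available : ∀ {x j j'} → PreviousLoop (x + m) → d x ≡ just j → d (x + m) ≡ just j' → j ≢ j' →
                    Available m Y d x j'
  rival-available {x} {j} {j'} previous dx dT j≢j' =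
    ≤-<-trans (completedLoops-mono j' (m≤m+n x m)) (proj₁ (started⇒available dT)) , not-in-loop
    where
    not-in-loop : ¬ InLoop m d x j'
    not-in-loop (ρ , ρ<x , _ , dρ) with previous dT (<-≤-trans ρ<x (m≤m+n x m)) dρ
    ... | x' , x'+m≡x+m , dx' =
      j≢j' (just-injective (trans (sym dx) (trans (cong d (sym (+-cancelʳ-≡ m x' x x'+m≡x+m))) dx')))

  rival-not-preferred : ∀ {x j j'} → PreviousLoop (x + m) → d x ≡ just j → d (x + m) ≡ just j' →
                        ¬ (j' ≻[ prio , tb ] j)
  rival-not-preferred previous dx dT j'≻j
    with started⇒preferred dx (rival-available previous dx dT (λ { refl → ≻-irrefl j'≻j }))
  ... | inj₁ refl = ≻-irrefl j'≻j
  ... | inj₂ j≻j' = ≻-asym j≻j' j'≻j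

  restart-from : ∀ {T} → PreviousLoop T → Restart T
  restart-from previous {x} {j} refl dx unfinished
    with ≢-nothing (λ idle → idle⇒unavailable idle j (available-after-loop dx unfinished))
  ... | j' , dT with started⇒preferred dT (available-after-loop dx unfinished)
  ...   | inj₁ j'≡j = trans dT (cong just j'≡j)
  ...   | inj₂ j'≻j = ⊥-elim (rival-not-preferred previous dx dT j'≻j)

  restart : ∀ T → Restart T
  restart = <-rec Restart (λ T restart-before → restart-from (previousLoop-from restart-before))

  previousLoop : ∀ T → PreviousLoop T
  previousLoop T = previousLoop-from (λ {T'} _ → restart T')

  loopStart : Fin n → ℕ → ℕ
  loopStart j c = c * m + firstStart j

  loopStart-suc : ∀ j c → loopStart j (suc c) ≡ loopStart j c + m
  loopStart-suc j c = trans (+-assoc m (c * m) (firstStart j)) (+-comm m (loopStart j c))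

  countBefore-during-loop : ∀ {x j} → d x ≡ just j → countBefore d j (x + m) ≡ countBefore d j (suc x)
  countBefore-during-loop {x} dx = countBefore-const d _ (m<m+n x (>-nonZero⁻¹ m))
    (λ x<y y<x+m dy → <⇒≱ y<x+m (start-gap dx dy x<y))

  loops-started : ∀ j c → c < Y j →
                  d (loopStart j c) ≡ just j × countBefore d j (suc (loopStart j c)) ≡ suc c
  loops-started j zero _ = firstStart-started j , (begin
    countBefore d j (suc (firstStart j)) ≡⟨ countBefore-start d (firstStart-started j) ⟩
    suc (countBefore d j (firstStart j))
      ≡⟨ cong suc (countBefore-const d j z≤n (λ _ → unstarted-before-firstStart j)) ⟩
    1                                    ∎)
    where open ≡-Reasoning
  loops-started j (suc c) c+1<Y = d-next , (begin
    countBefore d j (suc (loopStart j (suc c))) ≡⟨ countBefore-start d d-next ⟩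
    suc (countBefore d j (loopStart j (suc c))) ≡⟨ cong (suc ∘ countBefore d j) (loopStart-suc j c) ⟩
    suc (countBefore d j (loopStart j c + m))   ≡⟨ cong suc (countBefore-during-loop d-this) ⟩
    suc (countBefore d j (suc (loopStart j c))) ≡⟨ cong suc count-this ⟩
    suc (suc c)                                 ∎)
    where
    open ≡-Reasoning
    c<Y = <-trans (n<1+n c) c+1<Y
    d-this : d (loopStart j c) ≡ just j
    d-this = proj₁ (loops-started j c c<Y)
    count-this : countBefore d j (suc (loopStart j c)) ≡ suc c
    count-this = proj₂ (loops-started j c c<Y)
    d-next : d (loopStart j (suc c)) ≡ just j
    d-next = restart _ (sym (loopStart-suc j c)) d-this (subst (_< Y j) (sym count-this) c+1<Y)

  starts-are-loops : ∀ {τ j} → d τ ≡ just j → ∃ λ c → c < Y j × τ ≡ loopStart j c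
  starts-are-loops {τ} {j} = <-rec (λ τ → d τ ≡ just j → ∃ λ c → c < Y j × τ ≡ loopStart j c) step τ
    where
    step : ∀ τ → (∀ {x} → x < τ → d x ≡ just j → ∃ λ c → c < Y j × x ≡ loopStart j c) →
           d τ ≡ just j → ∃ λ c → c < Y j × τ ≡ loopStart j c
    step τ earlier dτ with <-cmp τ (firstStart j)
    ... | tri< τ<t _ _ = ⊥-elim (unstarted-before-firstStart j τ<t dτ)
    ... | tri≈ _ τ≡t _ = 0 , Y≥1 j , τ≡t
    ... | tri> _ _ t<τ with previousLoop τ dτ t<τ (firstStart-started j)
    ...   | x , refl , dx with earlier (m<m+n x (>-nonZero⁻¹ m)) dx
    ...     | c , c<Y , refl = suc c , c+1<Y , sym (loopStart-suc j c)
      where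
      c+1<Y : suc c < Y j
      c+1<Y = subst (_< Y j)
        (trans (completedLoops-after (loopStart j c) j) (proj₂ (loops-started j c c<Y)))
        (proj₁ (started⇒available dτ))

  idle⇒started : ∀ {τ} → d τ ≡ nothing → ∀ j → firstStart j < τ
  idle⇒started {τ} dτ j with <-cmp (firstStart j) τ
  ... | tri< t<τ _ _ = t<τ
  ... | tri≈ _ refl _ with () ← trans (sym (firstStart-started j)) dτ
  ... | tri> _ _ τ<t = ⊥-elim (idle⇒unavailable dτ j
                         (unstarted⇒available (λ ρ<τ → unstarted-before-firstStart j (<-trans ρ<τ τ<t))))

  firstStart-preferred : ∀ {j j'} → firstStart j < firstStart j' → j ≻[ prio , tb ] j'
  firstStart-preferred {j} {j'} t<t'
    with started⇒preferred (firstStart-started j)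
           (unstarted⇒available (λ ρ<t → unstarted-before-firstStart j' (<-trans ρ<t t<t')))
  ... | inj₁ refl = ⊥-elim (<-irrefl refl t<t')
  ... | inj₂ j≻j' = j≻j'

module Timing (m : ℕ) .{{_ : NonZero m}} (a : Fin m → ℕ) where

  machine : ℕ → Fin m
  machine τ = τ mod m

  execTime : ℕ → ℕ
  execTime τ = τ / m + a (machine τ)

  decisionTime : Fin m → ℕ → ℕ
  decisionTime i s = m * (s ∸ a i) + toℕ i

  toℕ-machine : ∀ τ → toℕ (machine τ) ≡ τ % m
  toℕ-machine τ = toℕ-fromℕ< (m%n<n τ m)

  machine-decisionTime : ∀ i s → machine (decisionTime i s) ≡ i
  machine-decisionTime i s = toℕ-injective (begin
    toℕ (machine (decisionTime i s))   ≡⟨ toℕ-machine _ ⟩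
    (m * (s ∸ a i) + toℕ i) % m        ≡⟨ %-remove-+ˡ (toℕ i) (m∣m*n (s ∸ a i)) ⟩
    toℕ i % m                          ≡⟨ m<n⇒m%n≡m (toℕ<n i) ⟩
    toℕ i                              ∎)
    where open ≡-Reasoning

  execTime-decisionTime : ∀ {i s} → a i ≤ s → execTime (decisionTime i s) ≡ s
  execTime-decisionTime {i} {s} aᵢ≤s = begin
    (m * (s ∸ a i) + toℕ i) / m + a (machine (decisionTime i s))
      ≡⟨ cong₂ _+_ (+-distrib-/-∣ˡ (toℕ i) (m∣m*n (s ∸ a i))) (cong a (machine-decisionTime i s)) ⟩
    (m * (s ∸ a i) / m + toℕ i / m) + a i
      ≡⟨ cong₂ (λ q r → q + r + a i) (trans (cong (_/ m) (*-comm m (s ∸ a i))) (m*n/n≡m (s ∸ a i) m))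
                                      (m<n⇒m/n≡0 (toℕ<n i)) ⟩
    (s ∸ a i + 0) + a i                ≡⟨ cong (_+ a i) (+-identityʳ (s ∸ a i)) ⟩
    s ∸ a i + a i                      ≡⟨ m∸n+n≡m aᵢ≤s ⟩
    s                                  ∎
    where open ≡-Reasoning

  decisionTime-execTime : ∀ τ → decisionTime (machine τ) (execTime τ) ≡ τ
  decisionTime-execTime τ = begin
    m * (τ / m + a (machine τ) ∸ a (machine τ)) + toℕ (machine τ)
      ≡⟨ cong₂ _+_ (cong (m *_) (m+n∸n≡m (τ / m) (a (machine τ)))) (toℕ-machine τ) ⟩
    m * (τ / m) + τ % m                ≡⟨ cong (_+ τ % m) (*-comm m (τ / m)) ⟩
    τ / m * m + τ % m                  ≡⟨ +-comm (τ / m * m) (τ % m) ⟩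
    τ % m + τ / m * m                  ≡⟨ m≡m%n+[m/n]*n τ m ⟨
    τ                                  ∎
    where open ≡-Reasoning

  machine-+loops : ∀ c τ → machine (c * m + τ) ≡ machine τ
  machine-+loops c τ = toℕ-injective (begin
    toℕ (machine (c * m + τ))   ≡⟨ toℕ-machine _ ⟩
    (c * m + τ) % m             ≡⟨ %-remove-+ˡ τ (n∣m*n c) ⟩
    τ % m                       ≡⟨ toℕ-machine τ ⟨
    toℕ (machine τ)             ∎)
    where open ≡-Reasoning

  execTime-+loops : ∀ c τ → execTime (c * m + τ) ≡ c + execTime τ
  execTime-+loops c τ = begin
    (c * m + τ) / m + a (machine (c * m + τ))
      ≡⟨ cong₂ _+_ (+-distrib-/-∣ˡ τ (n∣m*n c)) (cong a (machine-+loops c τ)) ⟩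
    (c * m / m + τ / m) + a (machine τ) ≡⟨ cong (λ q → q + τ / m + a (machine τ)) (m*n/n≡m c m) ⟩
    (c + τ / m) + a (machine τ)         ≡⟨ +-assoc c (τ / m) (a (machine τ)) ⟩
    c + execTime τ                      ∎
    where open ≡-Reasoning

  module _ (a≤1 : ∀ i → a i ≤ 1) (a-mono : ∀ {i i'} → toℕ i ≤ toℕ i' → a i ≤ a i') where

    execTime-mono : ∀ {τ τ'} → τ ≤ τ' → execTime τ ≤ execTime τ'
    execTime-mono {τ} {τ'} τ≤τ' with m≤n⇒m<n∨m≡n (/-monoˡ-≤ m τ≤τ')
    ... | inj₁ q<q' = begin
      τ / m + a (machine τ)    ≤⟨ +-monoʳ-≤ (τ / m) (a≤1 (machine τ)) ⟩
      τ / m + 1                ≡⟨ +-comm (τ / m) 1 ⟩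
      suc (τ / m)              ≤⟨ q<q' ⟩
      τ' / m                   ≤⟨ m≤m+n (τ' / m) _ ⟩
      execTime τ'              ∎
      where open ≤-Reasoning
    ... | inj₂ q≡q' = subst (λ q → τ / m + a (machine τ) ≤ q + a (machine τ')) q≡q'
                        (+-monoʳ-≤ (τ / m) (a-mono (subst₂ _≤_ (sym (toℕ-machine τ)) (sym (toℕ-machine τ')) r≤r')))
      where
      τ'≡r'+qm : τ' ≡ τ' % m + τ / m * m
      τ'≡r'+qm = trans (m≡m%n+[m/n]*n τ' m) (cong (λ q → τ' % m + q * m) (sym q≡q'))
      r≤r' : τ % m ≤ τ' % m
      r≤r' = +-cancelʳ-≤ (τ / m * m) (τ % m) (τ' % m) (subst₂ _≤_ (m≡m%n+[m/n]*n τ m) τ'≡r'+qm τ≤τ')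

-- induced m k d unfolds to induce m (arrival m k) d.
induce : ∀ {n} (m : ℕ) → (Fin m → ℕ) → (ℕ → Maybe (Fin n)) → Fin m → ℕ → Maybe (Fin n)
induce m a d i s = if a i ≤ᵇ s then d (m * (s ∸ a i) + toℕ i) else nothing

module _ {n m : ℕ} .{{_ : NonZero m}} (a : Fin m → ℕ) (d : ℕ → Maybe (Fin n)) where

  open Timing m a

  induce-arrived : ∀ {i s} → a i ≤ s → induce m a d i s ≡ d (decisionTime i s)
  induce-arrived {i} {s} aᵢ≤s with a i ≤ᵇ s | ≤ᵇ-reflects-≤ (a i) s
  ... | true  | _          = refl
  ... | false | ofⁿ aᵢ≰s = ⊥-elim (aᵢ≰s aᵢ≤s)

  induce-busy⇒arrived : ∀ {i s j} → induce m a d i s ≡ just j → a i ≤ s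
  induce-busy⇒arrived {i} {s} busy with a i ≤ᵇ s | ≤ᵇ-reflects-≤ (a i) s
  ... | true  | ofʸ aᵢ≤s = aᵢ≤s
  ... | false | _        with () ← busy

induce-isListSchedule :
  ∀ {m n} .{{_ : NonZero m}} (a : Fin m → ℕ) →
  (∀ i → a i ≤ 1) → (∀ {i i'} → toℕ i ≤ toℕ i' → a i ≤ a i') →
  ∀ {Y : Fin n → ℕ} {prio tb d} → (∀ j → 1 ≤ Y j) → IsFlowShopPriorityRun m n Y prio tb d →
  IsListSchedule m n a Y prio tb (induce m a d)
induce-isListSchedule {m} {n} a a≤1 a-mono {Y} {prio} {tb} {d} Y≥1 run =
  μ , b , processed⇒window , window⇒processed , (λ j → m≤n+m _ _) , idle⇒all-started , earlier⇒preferred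
  where
  open PriorityRun Y≥1 run
  open Timing m a

  μ : Fin n → Fin m
  μ j = machine (firstStart j)

  b : Fin n → ℕ
  b j = execTime (firstStart j)

  slot-of-loop : ∀ j c → decisionTime (μ j) (c + b j) ≡ loopStart j c
  slot-of-loop j c = begin
    decisionTime (machine (firstStart j)) (c + execTime (firstStart j))
      ≡⟨ cong₂ decisionTime (sym (machine-+loops c (firstStart j))) (sym (execTime-+loops c (firstStart j))) ⟩
    decisionTime (machine (loopStart j c)) (execTime (loopStart j c))
      ≡⟨ decisionTime-execTime (loopStart j c) ⟩
    loopStart j c ∎
    where open ≡-Reasoning

  loop-of-slot : ∀ {i s j c} → a i ≤ s → decisionTime i s ≡ loopStart j c → μ j ≡ i × c + b j ≡ s
  loop-of-slot {i} {s} {j} {c} aᵢ≤s slot≡loop =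
    trans (sym (machine-+loops c (firstStart j))) (trans (cong machine (sym slot≡loop)) (machine-decisionTime i s)) ,
    trans (sym (execTime-+loops c (firstStart j))) (trans (cong execTime (sym slot≡loop)) (execTime-decisionTime aᵢ≤s))

  processed⇒window : ∀ i s j → induce m a d i s ≡ just j → μ j ≡ i × b j ≤ s × s < b j + Y j
  processed⇒window i s j busy
    with starts-are-loops (trans (sym (induce-arrived a d (induce-busy⇒arrived a d busy))) busy)
  ... | c , c<Y , slot≡loop with loop-of-slot {j = j} {c} (induce-busy⇒arrived a d busy) slot≡loop
  ...   | μj≡i , c+b≡s =
    μj≡i , subst (b j ≤_) c+b≡s (m≤n+m (b j) c) ,
    subst (_< b j + Y j) (trans (+-comm (b j) c) c+b≡s) (+-monoʳ-< (b j) c<Y)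

  window⇒processed : ∀ i s j → μ j ≡ i → b j ≤ s → s < b j + Y j → induce m a d i s ≡ just j
  window⇒processed .(μ j) s j refl b≤s s<b+Y = begin
    induce m a d (μ j) s              ≡⟨ induce-arrived a d (≤-trans (m≤n+m _ _) b≤s) ⟩
    d (decisionTime (μ j) s)          ≡⟨ cong (d ∘ decisionTime (μ j)) (sym (m∸n+n≡m b≤s)) ⟩
    d (decisionTime (μ j) (c + b j))  ≡⟨ cong d (slot-of-loop j c) ⟩
    d (loopStart j c)                 ≡⟨ proj₁ (loops-started j c c<Y) ⟩
    just j                            ∎
    where
    open ≡-Reasoning
    c = s ∸ b j
    c<Y : c < Y j
    c<Y = +-cancelˡ-< (b j) c (Y j) (subst (_< b j + Y j) (sym (m+[n∸m]≡n b≤s)) s<b+Y)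

  idle⇒all-started : ∀ i s → a i ≤ s → induce m a d i s ≡ nothing → ∀ j → b j ≤ s
  idle⇒all-started i s aᵢ≤s idle j = subst (b j ≤_) (execTime-decisionTime aᵢ≤s)
    (execTime-mono a≤1 a-mono (<⇒≤ (idle⇒started (trans (sym (induce-arrived a d aᵢ≤s)) idle) j)))

  earlier⇒preferred : ∀ j j' → b j < b j' → j ≻[ prio , tb ] j'
  earlier⇒preferred j j' b<b' =
    firstStart-preferred (≰⇒> (λ t'≤t → <⇒≱ b<b' (execTime-mono a≤1 a-mono t'≤t)))

arrival-≤1 : ∀ m k i → arrival m k i ≤ 1
arrival-≤1 m k i with toℕ i + k ≤ᵇ m
... | true  = z≤n
... | false = ≤-refl

arrival-mono : ∀ m k {i i' : Fin m} → toℕ i ≤ toℕ i' → arrival m k i ≤ arrival m k i'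
arrival-mono m k {i} {i'} i≤i' with toℕ i' + k ≤ᵇ m | ≤ᵇ-reflects-≤ (toℕ i' + k) m
... | false | _            = arrival-≤1 m k i
... | true  | ofʸ i'+k≤m with toℕ i + k ≤ᵇ m | ≤ᵇ-reflects-≤ (toℕ i + k) m
...   | true  | _          = z≤n
...   | false | ofⁿ i+k≰m = ⊥-elim (i+k≰m (≤-trans (+-monoˡ-≤ k i≤i') i'+k≤m))

lemma4 : (m n : ℕ) (Y : Fin n → ℕ) → (∀ j → 1 ≤ Y j)
    → (prio tb : Fin n → ℕ) → Injective _≡_ _≡_ tb
    → (d : ℕ → Maybe (Fin n)) → IsFlowShopPriorityRun m n Y prio tb d
    → (k : ℕ) → 1 ≤ k → k ≤ m
    → IsListSchedule m n (arrival m k) Y prio tb (induced m k d)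
lemma4 m n Y Y≥1 prio tb _ d run k 1≤k k≤m =
  induce-isListSchedule {{>-nonZero (≤-trans 1≤k k≤m)}} (arrival m k) (arrival-≤1 m k) (arrival-mono m k) Y≥1 run
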